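{- Let $\mathbb{K}$ be a field extension of $\mathbb F_q$, let $u_1,u_2,u_3,w_1,w_2,w_3$ be distinct elements of $\mathbb{K}$, and define $a,b,c,d \in \mathbb{K}$ by the following equality in $\mathrm{GL}_2(\mathbb{K})$: \[ \begin{pmatrix} a & b\\ c & d\end{pmatrix} = \begin{pmatrix} w_3^q & w_1^q\\ 1 & 1\end{pmatrix}\begin{pmatrix} w_1^q-w_2^q & 0\\ 0 & w_2^q-w_3^q\end{pmatrix}\begin{pmatrix} u_2-u_3 & 0\\ 0 & u_1-u_2\end{pmatrix}\begin{pmatrix} 1 & -u_1\\ -1 & u_3\end{pmatrix}. \] Then the Möbius transformation $t \mapsto \frac{at+b}{ct+d}$ of $\mathbb P^1(\mathbb{K})$ sends $u_1,u_2,u_3$ to $w_1^q,w_2^q,w_3^q$ respectively. Suppose moreover that $\mathbb{K}$ carries a discrete valuation $v\colon \mathbb{K}^\times \to \mathbb Z$ with valuation ring $\mathcal{O}_v$, that all $u_i,w_i$ lie in $\mathcal{O}_v$, that $v(w_i-w_j) = v(w_3+u_i) = v(u_2-u_3)=0$ for all $i\neq j$, and that $v(u_1-u_2)=1$. Then, with $\pi_v$ a generator of the maximal ideal of $\mathcal{O}_v$, the elements $a,b,c,d$ satisfy \[ v(ad-bc)=1\,,\qquad v(d^qc - ac^q) = 0\,,\qquad c\lambda^q - c^q(ad-bc)\lambda^{ -1} \not\equiv d^qc - ac^q \pmod{\pi_v^2}\ \text{ for all } \lambda \in \mathcal{O}_v^\times\,. \] -}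

module Defs where

open import Level using (_⊔_)
open import Algebra.Bundles using (CommutativeRing; Semiring)
open import Data.Nat as ℕ using (ℕ; suc)
open import Data.Nat.Primality using (Prime)
open import Data.Integer as ℤ using (ℤ; +_)
open import Data.Fin using (Fin)
open import Data.List using (List; []; _∷_)
open import Data.List.Relation.Unary.AllPairs using (AllPairs)
open import Data.Product using (Σ; ∃; _×_; _,_)
open import Relation.Nullary using (¬_)
open import Relation.Binary.PropositionalEquality using (_≡_)

-- ℤ ∪ {∞}, the codomain of a valuation (v 0 = ∞)

data ℤ∞ : Set where
  fin : ℤ → ℤ∞
  ∞   : ℤ∞

_+∞_ : ℤ∞ → ℤ∞ → ℤ∞
fin m +∞ fin n = fin (m ℤ.+ n)
fin _ +∞ ∞     = ∞
∞     +∞ _     = ∞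

data _≤∞_ : ℤ∞ → ℤ∞ → Set where
  fin≤fin : ∀ {m n} → m ℤ.≤ n → fin m ≤∞ fin n
  _≤∞∞    : ∀ x → x ≤∞ ∞

min∞ : ℤ∞ → ℤ∞ → ℤ∞
min∞ (fin m) (fin n) = fin (m ℤ.⊓ n)
min∞ (fin m) ∞       = fin m
min∞ ∞       y       = y

module _ {c ℓ} (K : CommutativeRing c ℓ) where
  open CommutativeRing K
  open import Algebra.Definitions.RawSemiring (Semiring.rawSemiring semiring) using (_^_) renaming (_×_ to _·ₙ_)

  record IsField : Set (c ⊔ ℓ) where
    field
      0≉1     : ¬ (0# ≈ 1#)
      inverse : ∀ x → ¬ (x ≈ 0#) → ∃ λ y → x * y ≈ 1#

  -- K is a field extension of 𝔽_q: q = p^k with p prime, k ≥ 1,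
  -- char K = p, and K contains q distinct roots of X^q - X
  -- (these form the unique copy of 𝔽_q inside K).

  record ExtensionOf𝔽 (q : ℕ) : Set (c ⊔ ℓ) where
    field
      p        : ℕ
      p-prime  : Prime p
      k        : ℕ
      k≥1      : 1 ℕ.≤ k
      q≡p^k    : q ≡ p ℕ.^ k
      char     : (p ·ₙ 1#) ≈ 0#
      𝔽q       : Fin q → Carrier
      𝔽q-inj   : ∀ i j → 𝔽q i ≈ 𝔽q j → i ≡ j
      𝔽q-roots : ∀ i → (𝔽q i ^ q) ≈ 𝔽q i

  Distinct : List Carrier → Set (c ⊔ ℓ)
  Distinct = AllPairs (λ x y → ¬ (x ≈ y))

  record M₂ : Set c where
    constructor mat
    field
      m₁₁ m₁₂ m₂₁ m₂₂ : Carrier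

  _·_ : M₂ → M₂ → M₂
  mat a b c' d · mat e f g h =
    mat (a * e + b * g) (a * f + b * h) (c' * e + d * g) (c' * f + d * h)

  det : M₂ → Carrier
  det (mat a b c' d) = a * d - b * c'

  theMatrix : ℕ → (u₁ u₂ u₃ w₁ w₂ w₃ : Carrier) → M₂
  theMatrix q u₁ u₂ u₃ w₁ w₂ w₃ =
    ((mat (w₃ ^ q) (w₁ ^ q) 1# 1#
      · mat (w₁ ^ q - w₂ ^ q) 0# 0# (w₂ ^ q - w₃ ^ q))
      · mat (u₂ - u₃) 0# 0# (u₁ - u₂))
      · mat 1# (- u₁) (- 1#) u₃

  -- The Möbius transformation t ↦ (a t + b)/(c t + d) of ℙ¹(K)
  -- (with invertible matrix) sends the finite point t to the finite point s.
  MöbiusSends : M₂ → Carrier → Carrier → Set ℓ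
  MöbiusSends (mat a b c' d) t s =
    ¬ (c' * t + d ≈ 0#) × (a * t + b ≈ s * (c' * t + d))

  record DiscreteValuation : Set (c ⊔ ℓ) where
    field
      v      : Carrier → ℤ∞
      v-cong : ∀ {x y} → x ≈ y → v x ≡ v y
      v-∞⇒0  : ∀ x → v x ≡ ∞ → x ≈ 0#
      v-0⇒∞  : ∀ x → x ≈ 0# → v x ≡ ∞
      v-*    : ∀ x y → v (x * y) ≡ v x +∞ v y
      v-+    : ∀ x y → min∞ (v x) (v y) ≤∞ v (x + y)
      v-surj : ∀ n → ∃ λ x → v x ≡ fin n

    _∈𝒪 : Carrier → Set
    x ∈𝒪 = fin (+ 0) ≤∞ v x

    _∈𝔪 : Carrier → Set
    x ∈𝔪 = fin (+ 1) ≤∞ v x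

    _∈𝒪ˣ : Carrier → Set (c ⊔ ℓ)
    x ∈𝒪ˣ = (x ∈𝒪) × Σ Carrier (λ y → (y ∈𝒪) × (x * y ≈ 1#))

    IsGenerator𝔪 : Carrier → Set (c ⊔ ℓ)
    IsGenerator𝔪 π = (π ∈𝔪) × (∀ x → x ∈𝔪 → Σ Carrier λ z → (z ∈𝒪) × (x ≈ π * z))

    CongMod : Carrier → Carrier → Carrier → Set (c ⊔ ℓ)
    CongMod m x y = Σ Carrier λ z → (z ∈𝒪) × (x - y ≈ m * z)

  pow : Carrier → ℕ → Carrier
  pow = _^_

module Submission where

-- Write Wᵢ = wᵢ^q, α = W₁ - W₂, β = W₂ - W₃, γ = u₂ - u₃ and δ = u₁ - u₂.
-- Multiplying out, c = αγ - βδ, a = W₃αγ - W₁βδ, d = -u₁αγ + u₃βδ and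
-- ad - bc = (W₃ - W₁)αβγ(u₃ - u₁)δ, and each cuᵢ + d is a product of such
-- differences; since x ↦ x^q is an injective ring endomorphism in
-- characteristic p, all of them are nonzero, which gives the first part.
--
-- Under the valuative hypotheses every factor except δ is a unit and
-- v(δ) = 1, so v(ad - bc) = 1.  Frobenius also turns the formulas into
-- d^q c - a c^q = αγ·T + δ·P with T = (αγ)^q (-u₁ - w₃)^q a unit, so
-- v(d^q c - a c^q) = 0.  For the last claim put μ = αγ(-u₁ - w₃), so that
-- T = μ^q, and expand the difference of the two sides of the congruence
-- as αγ(t^q - T) + δB + (a multiple of δ^(q+1)).  Reducing modulo 𝔪 gives
-- t^q ≡ μ^q, hence t ≡ μ and t^q ≡ T modulo 𝔪²; then δB ∈ 𝔪², so B ∈ 𝔪.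
-- Finally t·B is congruent modulo 𝔪 to an explicit element
-- B₀ = -(αγ)^(q+1) β (W₃ - W₁)(w₃ + u₃), which is a unit: a contradiction.

open import Defs
open import Algebra.Bundles using (CommutativeRing; CommutativeSemiring; RawRing)
open import Algebra.Solver.Ring.AlmostCommutativeRing using (_-Raw-AlmostCommutative⟶_; fromCommutativeRing)
open import Data.Empty using (⊥-elim)
open import Data.Fin as Fin using (toℕ; fromℕ)
import Data.Fin.Properties as Fin
open import Data.Integer as ℤ using (+_; -[1+_]; +≤+)
import Data.Integer.Properties as ℤ
open import Data.List using ([]; _∷_)
open import Data.List.Relation.Unary.All using ([]; _∷_)
open import Data.List.Relation.Unary.AllPairs using ([]; _∷_)
import Data.Maybe as Maybe
open import Data.Maybe using (Maybe)
open import Data.Nat as ℕ using (ℕ; zero; suc; z≤n; s≤s; z<s; _∸_; _!; _<_)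
import Data.Nat.Properties as ℕ
open import Data.Nat.Combinatorics using (_C_; nCk≡n!/k![n-k]!; k![n∸k]!∣n!; nCn≡1)
open import Data.Nat.Divisibility using (_∣_; divides; ∣1⇒≡1; ∣⇒≤; m∣m*n)
open import Data.Nat.DivMod using (m/n*n≡m)
open import Data.Nat.Primality using (Prime; euclidsLemma; prime⇒nonTrivial)
open import Data.Product using (_×_; _,_)
open import Data.Product.Properties using (≡-dec)
open import Data.Sum using (_⊎_; inj₁; inj₂)
open import Data.Vec.Functional using (tail; init; last; replicate)
open import Level using (0ℓ; _⊔_)
open import Relation.Binary.Consequences using (dec⇒weaklyDec)
open import Relation.Binary.PropositionalEquality as ≡ using (_≡_)
open import Relation.Nullary using (¬_; contradiction)

module IntegerCoefficients {o ℓ} (K : CommutativeRing o ℓ) where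
  open CommutativeRing K
  open import Algebra.Properties.Ring ring using (-‿+-comm; ⁻¹-anti-homo‿-; x[y-z]≈xy-xz; [y-z]x≈yx-zx; -0#≈0#)
  open import Algebra.Properties.Semiring.Mult semiring using (×-homo-+; ×1-homo-*) renaming (_×_ to _·ₙ_)
  open import Algebra.Properties.CommutativeSemigroup +-commutativeSemigroup using (interchange)
  open import Relation.Binary.Reasoning.Setoid setoid

  -- The pair (m , n) stands for the integer m - n.  Results are normalised,
  -- so every integer has a unique representative and the solver may
  -- compare coefficients with _≡_.
  normalise : ℕ × ℕ → ℕ × ℕ
  normalise (m , n) = (m ∸ n , n ∸ m)

  _+ᵖ_ _*ᵖ_ : ℕ × ℕ → ℕ × ℕ → ℕ × ℕ
  (m , n) +ᵖ (m′ , n′) = normalise (m ℕ.+ m′ , n ℕ.+ n′)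
  (m , n) *ᵖ (m′ , n′) = normalise (m ℕ.* m′ ℕ.+ n ℕ.* n′ , m ℕ.* n′ ℕ.+ n ℕ.* m′)

  -ᵖ_ : ℕ × ℕ → ℕ × ℕ
  -ᵖ (m , n) = (n , m)

  ℤ-pairs : RawRing 0ℓ 0ℓ
  ℤ-pairs = record
    { Carrier = ℕ × ℕ
    ; _≈_     = _≡_
    ; _+_     = _+ᵖ_
    ; _*_     = _*ᵖ_
    ; -_      = -ᵖ_
    ; 0#      = (0 , 0)
    ; 1#      = (1 , 0)
    }

  difference : ℕ × ℕ → Carrier
  difference (m , n) = m ·ₙ 1# - n ·ₙ 1#

  -- The representatives of 0 and 1 go to 0# and 1# on the nose, so that
  -- these constants (as in the matrices of the theorem) are recognised.
  coefficient : ℕ × ℕ → Carrier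
  coefficient (0 , 0) = 0#
  coefficient (1 , 0) = 1#
  coefficient x       = difference x

  x-0#≈x : ∀ x → x - 0# ≈ x
  x-0#≈x x = trans (+-congˡ -0#≈0#) (+-identityʳ x)

  coefficient≈difference : ∀ x → coefficient x ≈ difference x
  coefficient≈difference (0 , 0)           = sym (x-0#≈x 0#)
  coefficient≈difference (1 , 0)           = sym (trans (x-0#≈x _) (+-identityʳ 1#))
  coefficient≈difference (0 , suc _)       = refl
  coefficient≈difference (1 , suc _)       = refl
  coefficient≈difference (suc (suc _) , _) = refl

  [x+y]-[z+w]≈[x-z]+[y-w] : ∀ x y z w → (x + y) - (z + w) ≈ (x - z) + (y - w)
  [x+y]-[z+w]≈[x-z]+[y-w] x y z w = begin
    (x + y) + - (z + w)    ≈⟨ +-congˡ (-‿+-comm z w) ⟨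
    (x + y) + (- z + - w)  ≈⟨ interchange x y (- z) (- w) ⟩
    (x - z) + (y - w)      ∎

  [xz+yw]-[xw+yz]≈[x-y][z-w] : ∀ x y z w → (x * z + y * w) - (x * w + y * z) ≈ (x - y) * (z - w)
  [xz+yw]-[xw+yz]≈[x-y][z-w] x y z w = begin
    (x * z + y * w) - (x * w + y * z)  ≈⟨ [x+y]-[z+w]≈[x-z]+[y-w] _ _ _ _ ⟩
    (x * z - x * w) + (y * w - y * z)  ≈⟨ +-congˡ (⁻¹-anti-homo‿- (y * z) (y * w)) ⟨
    (x * z - x * w) - (y * z - y * w)  ≈⟨ +-cong (x[y-z]≈xy-xz x z w) (-‿cong (x[y-z]≈xy-xz y z w)) ⟨
    x * (z - w) - y * (z - w)          ≈⟨ [y-z]x≈yx-zx (z - w) x y ⟨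
    (x - y) * (z - w)                  ∎

  difference-normalise : ∀ m n → difference (normalise (m , n)) ≈ difference (m , n)
  difference-normalise zero    zero    = refl
  difference-normalise zero    (suc n) = refl
  difference-normalise (suc m) zero    = refl
  difference-normalise (suc m) (suc n) = begin
    difference (normalise (m , n))   ≈⟨ difference-normalise m n ⟩
    m ·ₙ 1# - n ·ₙ 1#                ≈⟨ +-identityˡ _ ⟨
    0# + (m ·ₙ 1# - n ·ₙ 1#)         ≈⟨ +-congʳ (-‿inverseʳ 1#) ⟨
    (1# - 1#) + (m ·ₙ 1# - n ·ₙ 1#)  ≈⟨ [x+y]-[z+w]≈[x-z]+[y-w] 1# _ 1# _ ⟨
    difference (suc m , suc n)       ∎

  difference-+ᵖ : ∀ x y → difference (x +ᵖ y) ≈ difference x + difference y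
  difference-+ᵖ (m , n) (m′ , n′) = begin
    difference (normalise (m ℕ.+ m′ , n ℕ.+ n′))  ≈⟨ difference-normalise (m ℕ.+ m′) (n ℕ.+ n′) ⟩
    (m ℕ.+ m′) ·ₙ 1# - (n ℕ.+ n′) ·ₙ 1#           ≈⟨ +-cong (×-homo-+ 1# m m′) (-‿cong (×-homo-+ 1# n n′)) ⟩
    (m ·ₙ 1# + m′ ·ₙ 1#) - (n ·ₙ 1# + n′ ·ₙ 1#)   ≈⟨ [x+y]-[z+w]≈[x-z]+[y-w] _ _ _ _ ⟩
    difference (m , n) + difference (m′ , n′)     ∎

  difference-*ᵖ : ∀ x y → difference (x *ᵖ y) ≈ difference x * difference y
  difference-*ᵖ (m , n) (m′ , n′) = begin
    difference (normalise (k , l))                 ≈⟨ difference-normalise k l ⟩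
    k ·ₙ 1# - l ·ₙ 1#                              ≈⟨ +-cong (·ₙ1#-homo m m′ n n′) (-‿cong (·ₙ1#-homo m n′ n m′)) ⟩
    (ι m * ι m′ + ι n * ι n′) - (ι m * ι n′ + ι n * ι m′)  ≈⟨ [xz+yw]-[xw+yz]≈[x-y][z-w] _ _ _ _ ⟩
    difference (m , n) * difference (m′ , n′)      ∎
    where
    k = m ℕ.* m′ ℕ.+ n ℕ.* n′
    l = m ℕ.* n′ ℕ.+ n ℕ.* m′
    ι : ℕ → Carrier
    ι i = i ·ₙ 1#
    ·ₙ1#-homo : ∀ i i′ j j′ → ι (i ℕ.* i′ ℕ.+ j ℕ.* j′) ≈ ι i * ι i′ + ι j * ι j′
    ·ₙ1#-homo i i′ j j′ = trans (×-homo-+ 1# (i ℕ.* i′) (j ℕ.* j′)) (+-cong (×1-homo-* i i′) (×1-homo-* j j′))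

  difference--ᵖ : ∀ x → difference (-ᵖ x) ≈ - difference x
  difference--ᵖ (m , n) = sym (⁻¹-anti-homo‿- (m ·ₙ 1#) (n ·ₙ 1#))

  homomorphism : ℤ-pairs -Raw-AlmostCommutative⟶ fromCommutativeRing K
  homomorphism = record
    { ⟦_⟧    = coefficient
    ; +-homo = λ x y → via-difference (x +ᵖ y) (trans (difference-+ᵖ x y) (+-cong (≈c x) (≈c y)))
    ; *-homo = λ x y → via-difference (x *ᵖ y) (trans (difference-*ᵖ x y) (*-cong (≈c x) (≈c y)))
    ; -‿homo = λ x → via-difference (-ᵖ x) (trans (difference--ᵖ x) (-‿cong (≈c x)))
    ; 0-homo = refl
    ; 1-homo = refl
    }
    where
    via-difference : ∀ x {y} → difference x ≈ y → coefficient x ≈ y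
    via-difference x = trans (coefficient≈difference x)
    ≈c : ∀ x → difference x ≈ coefficient x
    ≈c x = sym (coefficient≈difference x)

  coefficient-≟ : ∀ x y → Maybe (coefficient x ≈ coefficient y)
  coefficient-≟ x y = Maybe.map (λ { ≡.refl → refl }) (dec⇒weaklyDec (≡-dec ℕ._≟_ ℕ._≟_) x y)

module RingSolver {o ℓ} (K : CommutativeRing o ℓ) where
  open IntegerCoefficients K using (ℤ-pairs; homomorphism; coefficient-≟)
  open import Algebra.Solver.Ring ℤ-pairs (fromCommutativeRing K) homomorphism coefficient-≟ public

-- Frobenius in characteristic p

prime∤! : ∀ {p} → Prime p → ∀ {m} → m < p → ¬ (p ∣ m !)
prime∤! {p} p-prime {zero}  _   p∣1 =
  contradiction (∣1⇒≡1 p∣1) (ℕ.>⇒≢ (ℕ.nonTrivial⇒n>1 p {{prime⇒nonTrivial p-prime}}))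
prime∤! p-prime {suc m} m<p p∣m! with euclidsLemma (suc m) (m !) p-prime p∣m!
... | inj₁ p∣1+m = ℕ.<⇒≱ m<p (∣⇒≤ p∣1+m)
... | inj₂ p∣m!  = prime∤! p-prime (ℕ.<-trans (ℕ.n<1+n m) m<p) p∣m!

choose*factorials≡! : ∀ {n k} → k ℕ.≤ n → (n C k) ℕ.* (k ! ℕ.* (n ∸ k) !) ≡ n !
choose*factorials≡! {n} {k} k≤n =
  ≡.trans (≡.cong (ℕ._* (k ! ℕ.* (n ∸ k) !)) (nCk≡n!/k![n-k]! k≤n)) (m/n*n≡m (k![n∸k]!∣n! k≤n))
  where instance _ = k ℕ.!* (n ∸ k) !≢0

prime∣choose : ∀ {p k} → Prime p → 0 < k → k < p → p ∣ p C k
prime∣choose {suc p} {k} p-prime 0<k k<p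
  with euclidsLemma (suc p C k) _ p-prime
         (≡.subst (suc p ∣_) (≡.sym (choose*factorials≡! (ℕ.<⇒≤ k<p))) (m∣m*n (p !)))
... | inj₁ p∣pCk = p∣pCk
... | inj₂ p∣k![p-k]! with euclidsLemma (k !) ((suc p ∸ k) !) p-prime p∣k![p-k]!
...   | inj₁ p∣k!     = contradiction p∣k! (prime∤! p-prime k<p)
...   | inj₂ p∣[p-k]! = contradiction p∣[p-k]! (prime∤! p-prime (ℕ.∸-monoʳ-< 0<k (ℕ.<⇒≤ k<p)))

module CharacteristicP {o ℓ} (R : CommutativeSemiring o ℓ) where
  open CommutativeSemiring R
  open import Algebra.Properties.Semiring.Mult semiring
    using (×-congʳ; ×-assoc-*; ×1-homo-*) renaming (_×_ to _·ₙ_)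
  open import Algebra.Properties.Semiring.Exp semiring using (_^_; ^-congˡ; ^-assocʳ; ^-congʳ)
  open import Algebra.Properties.Semiring.Sum semiring using (sum; sum-init-last; sum-cong-≋; sum-replicate-zero)
  open import Algebra.Properties.CommutativeSemiring.Binomial R using (theorem; binomialTerm)
  open import Relation.Binary.Reasoning.Setoid setoid

  m·ₙx≈[m·ₙ1#]*x : ∀ m x → m ·ₙ x ≈ (m ·ₙ 1#) * x
  m·ₙx≈[m·ₙ1#]*x m x = trans (×-congʳ m (sym (*-identityˡ x))) (sym (×-assoc-* m 1# x))

  ∣⇒·ₙ≈0 : ∀ {p m} → p ·ₙ 1# ≈ 0# → p ∣ m → ∀ x → m ·ₙ x ≈ 0#
  ∣⇒·ₙ≈0 {p} char (divides j ≡.refl) x = begin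
    (j ℕ.* p) ·ₙ x              ≈⟨ m·ₙx≈[m·ₙ1#]*x (j ℕ.* p) x ⟩
    ((j ℕ.* p) ·ₙ 1#) * x       ≈⟨ *-congʳ (×1-homo-* j p) ⟩
    (j ·ₙ 1#) * (p ·ₙ 1#) * x   ≈⟨ *-congʳ (*-congˡ char) ⟩
    (j ·ₙ 1#) * 0# * x          ≈⟨ *-congʳ (zeroʳ _) ⟩
    0# * x                      ≈⟨ zeroˡ x ⟩
    0#                          ∎

  -- Only the outer terms of the binomial expansion survive, because p
  -- divides every inner binomial coefficient.
  freshman's-dream : ∀ {p} → Prime p → p ·ₙ 1# ≈ 0# → ∀ x y → (x + y) ^ p ≈ x ^ p + y ^ p
  freshman's-dream {suc (suc m)} p-prime char x y = begin
    (x + y) ^ p                                         ≈⟨ theorem p x y ⟩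
    t Fin.zero + sum (tail t)                           ≈⟨ +-congˡ (sum-init-last (tail t)) ⟩
    t Fin.zero + (sum (init (tail t)) + last (tail t))  ≈⟨ +-cong first-term (+-cong inner-terms last-term) ⟩
    y ^ p + (0# + x ^ p)                                ≈⟨ +-comm _ _ ⟩
    (0# + x ^ p) + y ^ p                                ≈⟨ +-congʳ (+-identityˡ _) ⟩
    x ^ p + y ^ p                                       ∎
    where
    p = suc (suc m)
    t = binomialTerm x y p
    first-term : t Fin.zero ≈ y ^ p
    first-term = trans (+-identityʳ _) (*-identityˡ _)
    inner-term : ∀ i → init (tail t) i ≈ 0#
    inner-term i = ∣⇒·ₙ≈0 char (prime∣choose p-prime z<s
      (s≤s (≡.subst (ℕ._< suc m) (≡.sym (Fin.toℕ-inject₁ i)) (Fin.toℕ<n i)))) _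
    inner-terms : sum (init (tail t)) ≈ 0#
    inner-terms = trans (sum-cong-≋ {y = replicate (suc m) 0#} inner-term) (sum-replicate-zero (suc m))
    last-term : last (tail t) ≈ x ^ p
    last-term = top-term (toℕ (fromℕ p)) (Fin.toℕ-fromℕ p)
      where
      top-term : ∀ k → k ≡ p → (p C k) ·ₙ (x ^ k * y ^ (p ℕ.∸ k)) ≈ x ^ p
      top-term .p ≡.refl rewrite nCn≡1 p | ℕ.n∸n≡0 p = trans (+-identityʳ _) (*-identityʳ _)

  freshman's-dream-^ : ∀ {p} → Prime p → p ·ₙ 1# ≈ 0# →
                       ∀ k x y → (x + y) ^ (p ℕ.^ k) ≈ x ^ (p ℕ.^ k) + y ^ (p ℕ.^ k)
  freshman's-dream-^ p-prime char zero x y =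
    trans (*-identityʳ _) (+-cong (sym (*-identityʳ x)) (sym (*-identityʳ y)))
  freshman's-dream-^ {p} p-prime char (suc k) x y = begin
    (x + y) ^ (p ℕ.^ suc k)                    ≈⟨ ^-p^[1+k] (x + y) ⟩
    ((x + y) ^ (p ℕ.^ k)) ^ p                  ≈⟨ ^-congˡ p (freshman's-dream-^ p-prime char k x y) ⟩
    (x ^ (p ℕ.^ k) + y ^ (p ℕ.^ k)) ^ p        ≈⟨ freshman's-dream p-prime char _ _ ⟩
    (x ^ (p ℕ.^ k)) ^ p + (y ^ (p ℕ.^ k)) ^ p  ≈⟨ +-cong (^-p^[1+k] x) (^-p^[1+k] y) ⟨
    x ^ (p ℕ.^ suc k) + y ^ (p ℕ.^ suc k)      ∎
    where
    ^-p^[1+k] : ∀ z → z ^ (p ℕ.^ suc k) ≈ (z ^ (p ℕ.^ k)) ^ p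
    ^-p^[1+k] z = sym (trans (^-assocʳ z (p ℕ.^ k) p) (^-congʳ z (ℕ.*-comm (p ℕ.^ k) p)))

-- Discrete valuations

≤∞-trans : ∀ {x y z} → x ≤∞ y → y ≤∞ z → x ≤∞ z
≤∞-trans (fin≤fin p) (fin≤fin q) = fin≤fin (ℤ.≤-trans p q)
≤∞-trans (fin≤fin _) (_ ≤∞∞)     = _ ≤∞∞
≤∞-trans (_ ≤∞∞)     (_ ≤∞∞)     = _ ≤∞∞

+∞-mono-≤ : ∀ {i j x y} → fin i ≤∞ x → fin j ≤∞ y → fin (i ℤ.+ j) ≤∞ (x +∞ y)
+∞-mono-≤ (fin≤fin p) (fin≤fin q) = fin≤fin (ℤ.+-mono-≤ p q)
+∞-mono-≤ (fin≤fin _) (_ ≤∞∞)     = _ ≤∞∞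
+∞-mono-≤ (_ ≤∞∞)     _           = _ ≤∞∞

min∞-glb : ∀ {i x y} → fin i ≤∞ x → fin i ≤∞ y → fin i ≤∞ min∞ x y
min∞-glb (fin≤fin p) (fin≤fin q) = fin≤fin (ℤ.⊓-glb p q)
min∞-glb (fin≤fin p) (_ ≤∞∞)     = fin≤fin p
min∞-glb (_ ≤∞∞)     q           = q

fin-injective : ∀ {i j} → fin i ≡ fin j → i ≡ j
fin-injective ≡.refl = ≡.refl

+∞-cancelˡ-≤ : ∀ i {j y} → fin (i ℤ.+ j) ≤∞ (fin i +∞ y) → fin j ≤∞ y
+∞-cancelˡ-≤ i {y = fin _} (fin≤fin i+j≤i+k) = fin≤fin (+-cancelˡ-≤ i+j≤i+k)
  where
  open ℤ.≤-Reasoning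
  +-cancelˡ-≤ : ∀ {j k} → i ℤ.+ j ℤ.≤ i ℤ.+ k → j ℤ.≤ k
  +-cancelˡ-≤ {j} {k} i+j≤i+k = begin
    j                    ≡⟨ -i+[i+l]≡l j ⟨
    ℤ.- i ℤ.+ (i ℤ.+ j)  ≤⟨ ℤ.+-monoʳ-≤ (ℤ.- i) i+j≤i+k ⟩
    ℤ.- i ℤ.+ (i ℤ.+ k)  ≡⟨ -i+[i+l]≡l k ⟩
    k                    ∎
    where
    -i+[i+l]≡l : ∀ l → ℤ.- i ℤ.+ (i ℤ.+ l) ≡ l
    -i+[i+l]≡l l =
      ≡.trans (≡.sym (ℤ.+-assoc (ℤ.- i) i l)) (≡.trans (≡.cong (ℤ._+ l) (ℤ.+-inverseˡ i)) (ℤ.+-identityˡ l))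
+∞-cancelˡ-≤ i {y = ∞} _ = _ ≤∞∞

module ValuationProperties {o ℓ} (K : CommutativeRing o ℓ)
  (0≉1 : ¬ CommutativeRing._≈_ K (CommutativeRing.0# K) (CommutativeRing.1# K))
  (V : DiscreteValuation K) where
  open CommutativeRing K
  open DiscreteValuation V
  open import Algebra.Properties.Ring ring using (-1*x≈-x; -‿involutive)
  open import Algebra.Properties.Semiring.Exp semiring using (_^_)

  -- _∈𝒪 and _∈𝔪 are the cases n = 0 and n = 1.
  _∈𝔪^_ : Carrier → ℕ → Set
  x ∈𝔪^ n = fin (+ n) ≤∞ v x

  IsUnit : Carrier → Set
  IsUnit x = v x ≡ fin (+ 0)

  ∈𝔪^-cong : ∀ {x y n} → x ≈ y → x ∈𝔪^ n → y ∈𝔪^ n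
  ∈𝔪^-cong {n = n} x≈y = ≡.subst (fin (+ n) ≤∞_) (v-cong x≈y)

  ∈𝔪^-weaken : ∀ {x m n} → m ℕ.≤ n → x ∈𝔪^ n → x ∈𝔪^ m
  ∈𝔪^-weaken m≤n = ≤∞-trans (fin≤fin (+≤+ m≤n))

  ≈0#⇒∈𝔪^ : ∀ {x} n → x ≈ 0# → x ∈𝔪^ n
  ≈0#⇒∈𝔪^ {x} n x≈0 = ≡.subst (fin (+ n) ≤∞_) (≡.sym (v-0⇒∞ x x≈0)) (_ ≤∞∞)

  -- Membership proofs are combined with the same operators as the elements.
  infix  8 ⟨-⟩_
  infixl 7 _⟨*⟩_
  infixl 6 _⟨+⟩_ _⟨-⟩_

  _⟨*⟩_ : ∀ {x y m n} → x ∈𝔪^ m → y ∈𝔪^ n → (x * y) ∈𝔪^ (m ℕ.+ n)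
  _⟨*⟩_ {x} {y} {m} {n} x∈ y∈ = ≡.subst (fin (+ (m ℕ.+ n)) ≤∞_) (≡.sym (v-* x y)) (+∞-mono-≤ x∈ y∈)

  _⟨+⟩_ : ∀ {x y n} → x ∈𝔪^ n → y ∈𝔪^ n → (x + y) ∈𝔪^ n
  _⟨+⟩_ {x} {y} x∈ y∈ = ≤∞-trans (min∞-glb x∈ y∈) (v-+ x y)

  v-1# : v 1# ≡ fin (+ 0)
  v-1# with v 1# in eq
  ... | ∞     = ⊥-elim (0≉1 (sym (v-∞⇒0 1# eq)))
  ... | fin i = ≡.cong fin (identityʳ-unique i i (fin-injective (begin
    fin (i ℤ.+ i)       ≡⟨ ≡.cong₂ _+∞_ eq eq ⟨
    v 1# +∞ v 1#        ≡⟨ v-* 1# 1# ⟨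
    v (1# * 1#)         ≡⟨ v-cong (*-identityʳ 1#) ⟩
    v 1#                ≡⟨ eq ⟩
    fin i               ∎)))
    where
    open ≡.≡-Reasoning
    open import Algebra.Properties.AbelianGroup ℤ.+-0-abelianGroup using (identityʳ-unique)

  v[x*x]≡0⇒v[x]≡0 : ∀ {x} → v (x * x) ≡ fin (+ 0) → v x ≡ fin (+ 0)
  v[x*x]≡0⇒v[x]≡0 {x} v[x*x]≡0 with v x in eq | ≡.trans (≡.sym (v-* x x)) v[x*x]≡0
  ... | fin (+ zero)  | _  = ≡.refl
  ... | fin (+ suc _) | ()
  ... | fin -[1+ _ ]  | ()
  ... | ∞             | ()

  v-neg : ∀ x → v (- x) ≡ v x
  v-neg x = begin
    v (- x)              ≡⟨ v-cong (-1*x≈-x x) ⟨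
    v (- 1# * x)         ≡⟨ v-* (- 1#) x ⟩
    v (- 1#) +∞ v x      ≡⟨ ≡.cong (_+∞ v x) v-neg1# ⟩
    fin (+ 0) +∞ v x     ≡⟨ 0+∞ (v x) ⟩
    v x                  ∎
    where
    open ≡.≡-Reasoning
    v-neg1# : v (- 1#) ≡ fin (+ 0)
    v-neg1# = v[x*x]≡0⇒v[x]≡0 (≡.trans (v-cong (trans (-1*x≈-x (- 1#)) (-‿involutive 1#))) v-1#)
    0+∞ : ∀ y → fin (+ 0) +∞ y ≡ y
    0+∞ (fin i) = ≡.cong fin (ℤ.+-identityˡ i)
    0+∞ ∞       = ≡.refl

  unit⇒∈𝒪 : ∀ {x} → IsUnit x → x ∈𝒪
  unit⇒∈𝒪 vx≡0 = ≡.subst (fin (+ 0) ≤∞_) (≡.sym vx≡0) (fin≤fin ℤ.≤-refl)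

  ⟨-⟩_ : ∀ {x n} → x ∈𝔪^ n → (- x) ∈𝔪^ n
  ⟨-⟩_ {x} {n} = ≡.subst (fin (+ n) ≤∞_) (≡.sym (v-neg x))

  _⟨-⟩_ : ∀ {x y n} → x ∈𝔪^ n → y ∈𝔪^ n → (x - y) ∈𝔪^ n
  x∈ ⟨-⟩ y∈ = x∈ ⟨+⟩ ⟨-⟩ y∈

  ∈𝔪^-^ : ∀ {x} n → x ∈𝔪 → (x ^ n) ∈𝔪^ n
  ∈𝔪^-^ zero    _  = unit⇒∈𝒪 v-1#
  ∈𝔪^-^ (suc n) x∈ = x∈ ⟨*⟩ ∈𝔪^-^ n x∈

  ∈𝒪-^ : ∀ {x} n → x ∈𝒪 → (x ^ n) ∈𝒪
  ∈𝒪-^ zero    _  = unit⇒∈𝒪 v-1#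
  ∈𝒪-^ (suc n) x∈ = x∈ ⟨*⟩ ∈𝒪-^ n x∈

  ∈𝔪^-cancelˡ : ∀ {x y m n} → v x ≡ fin (+ m) → (x * y) ∈𝔪^ (m ℕ.+ n) → y ∈𝔪^ n
  ∈𝔪^-cancelˡ {x} {y} {m} {n} vx≡m xy∈ =
    +∞-cancelˡ-≤ (+ m) (≡.subst (fin (+ m ℤ.+ + n) ≤∞_) (≡.trans (v-* x y) (≡.cong (_+∞ v y) vx≡m)) xy∈)

  unit-cong : ∀ {x y} → x ≈ y → IsUnit x → IsUnit y
  unit-cong x≈y = ≡.trans (≡.sym (v-cong x≈y))

  unit-* : ∀ {x y} → IsUnit x → IsUnit y → IsUnit (x * y)
  unit-* {x} {y} vx≡0 vy≡0 = ≡.trans (v-* x y) (≡.cong₂ _+∞_ vx≡0 vy≡0)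

  unit-neg : ∀ {x} → IsUnit x → IsUnit (- x)
  unit-neg {x} = ≡.trans (v-neg x)

  unit-^ : ∀ {x} n → IsUnit x → IsUnit (x ^ n)
  unit-^ zero    _      = v-1#
  unit-^ (suc n) x-unit = unit-* x-unit (unit-^ n x-unit)

  unit∉𝔪 : ∀ {x} → IsUnit x → ¬ (x ∈𝔪)
  unit∉𝔪 vx≡0 x∈𝔪 with ≡.subst (fin (+ 1) ≤∞_) vx≡0 x∈𝔪
  ... | fin≤fin (+≤+ ())

  ∈𝒪⇒unit⊎∈𝔪 : ∀ {x} → x ∈𝒪 → IsUnit x ⊎ x ∈𝔪
  ∈𝒪⇒unit⊎∈𝔪 {x} x∈𝒪 with v x | x∈𝒪
  ... | fin (+ zero)  | _ = inj₁ ≡.refl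
  ... | fin (+ suc _) | _ = inj₂ (fin≤fin (+≤+ (s≤s z≤n)))
  ... | fin -[1+ _ ]  | fin≤fin ()
  ... | ∞             | _ = inj₂ (_ ≤∞∞)

  ∈𝔪^-+⁻ˡ : ∀ {x y n} → (x + y) ∈𝔪^ n → y ∈𝔪^ n → x ∈𝔪^ n
  ∈𝔪^-+⁻ˡ {x} {y} x+y∈ y∈ = ∈𝔪^-cong [x+y]-y≈x (x+y∈ ⟨-⟩ y∈)
    where
    [x+y]-y≈x : (x + y) - y ≈ x
    [x+y]-y≈x = trans (+-assoc x y (- y)) (trans (+-congˡ (-‿inverseʳ y)) (+-identityʳ x))

  ∈𝔪^-+⁻ʳ : ∀ {x y n} → (x + y) ∈𝔪^ n → x ∈𝔪^ n → y ∈𝔪^ n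
  ∈𝔪^-+⁻ʳ {x} {y} x+y∈ = ∈𝔪^-+⁻ˡ (∈𝔪^-cong (+-comm x y) x+y∈)

  unit+∈𝔪 : ∀ {x y} → IsUnit x → y ∈𝔪 → IsUnit (x + y)
  unit+∈𝔪 {x} {y} x-unit y∈𝔪 with ∈𝒪⇒unit⊎∈𝔪 (unit⇒∈𝒪 x-unit ⟨+⟩ ∈𝔪^-weaken z≤n y∈𝔪)
  ... | inj₁ x+y-unit = x+y-unit
  ... | inj₂ x+y∈𝔪    = ⊥-elim (unit∉𝔪 x-unit (∈𝔪^-+⁻ˡ x+y∈𝔪 y∈𝔪))

  ^-∈𝔪⇒∈𝔪 : ∀ {x} n → x ∈𝒪 → (x ^ suc n) ∈𝔪 → x ∈𝔪
  ^-∈𝔪⇒∈𝔪 n x∈𝒪 xⁿ∈𝔪 with ∈𝒪⇒unit⊎∈𝔪 x∈𝒪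
  ... | inj₁ x-unit = ⊥-elim (unit∉𝔪 (unit-^ (suc n) x-unit) xⁿ∈𝔪)
  ... | inj₂ x∈𝔪    = x∈𝔪

module FieldProperties {o ℓ} (K : CommutativeRing o ℓ) (K-field : IsField K) where
  open CommutativeRing K
  open IsField K-field
  open import Algebra.Properties.Semiring.Exp semiring using (_^_)
  open import Relation.Binary.Reasoning.Setoid setoid

  *-≉0 : ∀ {x y} → ¬ x ≈ 0# → ¬ y ≈ 0# → ¬ (x * y) ≈ 0#
  *-≉0 {x} {y} x≉0 y≉0 xy≈0 with inverse x x≉0
  ... | x⁻¹ , xx⁻¹≈1 = y≉0 (begin
    y                ≈⟨ *-identityˡ y ⟨
    1# * y           ≈⟨ *-congʳ (trans (sym xx⁻¹≈1) (*-comm x x⁻¹)) ⟩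
    (x⁻¹ * x) * y    ≈⟨ *-assoc x⁻¹ x y ⟩
    x⁻¹ * (x * y)    ≈⟨ *-congˡ xy≈0 ⟩
    x⁻¹ * 0#         ≈⟨ zeroʳ x⁻¹ ⟩
    0#               ∎)

  ^-≉0 : ∀ {x} n → ¬ x ≈ 0# → ¬ (x ^ n) ≈ 0#
  ^-≉0 zero    _   1≈0 = 0≉1 (sym 1≈0)
  ^-≉0 (suc n) x≉0     = *-≉0 x≉0 (^-≉0 n x≉0)

AdditivePower : ∀ {o ℓ} → CommutativeRing o ℓ → ℕ → Set (o ⊔ ℓ)
AdditivePower K n = ∀ x y → pow K (x + y) n ≈ pow K x n + pow K y n
  where open CommutativeRing K

module TheMatrix {o ℓ} (K : CommutativeRing o ℓ) (q : ℕ)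
  (u₁ u₂ u₃ w₁ w₂ w₃ : CommutativeRing.Carrier K) where
  open CommutativeRing K
  open RingSolver K
  open import Algebra.Properties.Semiring.Exp semiring using (_^_)

  W₁ W₂ W₃ α β γ δ X D : Carrier
  W₁ = w₁ ^ q
  W₂ = w₂ ^ q
  W₃ = w₃ ^ q
  α  = W₁ - W₂
  β  = W₂ - W₃
  γ  = u₂ - u₃
  δ  = u₁ - u₂
  X  = α * γ
  D  = (W₃ - W₁) * α * β * γ * (u₃ - u₁)

  A : M₂ K
  A = theMatrix K q u₁ u₂ u₃ w₁ w₂ w₃
  open M₂ A public renaming (m₁₁ to a; m₁₂ to b; m₂₁ to c; m₂₂ to d)

  record Matₚ (n : ℕ) : Set where
    constructor matₚ
    field m₁₁ m₁₂ m₂₁ m₂₂ : Polynomial n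

  _·ₚ_ : ∀ {n} → Matₚ n → Matₚ n → Matₚ n
  matₚ a b c d ·ₚ matₚ e f g h =
    matₚ (a :* e :+ b :* g) (a :* f :+ b :* h) (c :* e :+ d :* g) (c :* f :+ d :* h)

  -- The product defining theMatrix, built from solver polynomials: the
  -- entries of theMatrix are definitionally their evaluations.
  theMatrixₚ : ∀ {n} (W₁ W₂ W₃ u₁ u₂ u₃ : Polynomial n) → Matₚ n
  theMatrixₚ W₁ W₂ W₃ u₁ u₂ u₃ =
    ((matₚ W₃ W₁ 1ₚ 1ₚ ·ₚ matₚ (W₁ :- W₂) 0ₚ 0ₚ (W₂ :- W₃)) ·ₚ matₚ (u₂ :- u₃) 0ₚ 0ₚ (u₁ :- u₂))
      ·ₚ matₚ 1ₚ (:- u₁) (:- 1ₚ) u₃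
    where
    0ₚ 1ₚ : Polynomial _
    0ₚ = con (0 , 0)
    1ₚ = con (1 , 0)

  c≈ : c ≈ X - β * δ
  c≈ = solve 6 (λ W₁ W₂ W₃ u₁ u₂ u₃ → let open Matₚ (theMatrixₚ W₁ W₂ W₃ u₁ u₂ u₃) in
    m₂₁ := (W₁ :- W₂) :* (u₂ :- u₃) :- (W₂ :- W₃) :* (u₁ :- u₂))
    refl W₁ W₂ W₃ u₁ u₂ u₃

  a≈ : a ≈ W₃ * X - W₁ * (β * δ)
  a≈ = solve 6 (λ W₁ W₂ W₃ u₁ u₂ u₃ → let open Matₚ (theMatrixₚ W₁ W₂ W₃ u₁ u₂ u₃) in
    m₁₁ := W₃ :* ((W₁ :- W₂) :* (u₂ :- u₃)) :- W₁ :* ((W₂ :- W₃) :* (u₁ :- u₂)))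
    refl W₁ W₂ W₃ u₁ u₂ u₃

  d≈ : d ≈ - u₁ * X + u₃ * (β * δ)
  d≈ = solve 6 (λ W₁ W₂ W₃ u₁ u₂ u₃ → let open Matₚ (theMatrixₚ W₁ W₂ W₃ u₁ u₂ u₃) in
    m₂₂ := :- u₁ :* ((W₁ :- W₂) :* (u₂ :- u₃)) :+ u₃ :* ((W₂ :- W₃) :* (u₁ :- u₂)))
    refl W₁ W₂ W₃ u₁ u₂ u₃

  det≈ : a * d - b * c ≈ D * δ
  det≈ = solve 6 (λ W₁ W₂ W₃ u₁ u₂ u₃ → let open Matₚ (theMatrixₚ W₁ W₂ W₃ u₁ u₂ u₃) in
    m₁₁ :* m₂₂ :- m₁₂ :* m₂₁ := (W₃ :- W₁) :* (W₁ :- W₂) :* (W₂ :- W₃) :* (u₂ :- u₃) :* (u₃ :- u₁) :* (u₁ :- u₂))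
    refl W₁ W₂ W₃ u₁ u₂ u₃

  denominator₁ : c * u₁ + d ≈ β * δ * (u₃ - u₁)
  denominator₁ = solve 6 (λ W₁ W₂ W₃ u₁ u₂ u₃ → let open Matₚ (theMatrixₚ W₁ W₂ W₃ u₁ u₂ u₃) in
    m₂₁ :* u₁ :+ m₂₂ := (W₂ :- W₃) :* (u₁ :- u₂) :* (u₃ :- u₁))
    refl W₁ W₂ W₃ u₁ u₂ u₃

  denominator₂ : c * u₂ + d ≈ δ * γ * (W₃ - W₁)
  denominator₂ = solve 6 (λ W₁ W₂ W₃ u₁ u₂ u₃ → let open Matₚ (theMatrixₚ W₁ W₂ W₃ u₁ u₂ u₃) in
    m₂₁ :* u₂ :+ m₂₂ := (u₁ :- u₂) :* (u₂ :- u₃) :* (W₃ :- W₁))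
    refl W₁ W₂ W₃ u₁ u₂ u₃

  denominator₃ : c * u₃ + d ≈ α * γ * (u₃ - u₁)
  denominator₃ = solve 6 (λ W₁ W₂ W₃ u₁ u₂ u₃ → let open Matₚ (theMatrixₚ W₁ W₂ W₃ u₁ u₂ u₃) in
    m₂₁ :* u₃ :+ m₂₂ := (W₁ :- W₂) :* (u₂ :- u₃) :* (u₃ :- u₁))
    refl W₁ W₂ W₃ u₁ u₂ u₃

  numerator₁ : a * u₁ + b ≈ W₁ * (c * u₁ + d)
  numerator₁ = solve 6 (λ W₁ W₂ W₃ u₁ u₂ u₃ → let open Matₚ (theMatrixₚ W₁ W₂ W₃ u₁ u₂ u₃) in
    m₁₁ :* u₁ :+ m₁₂ := W₁ :* (m₂₁ :* u₁ :+ m₂₂))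
    refl W₁ W₂ W₃ u₁ u₂ u₃

  numerator₂ : a * u₂ + b ≈ W₂ * (c * u₂ + d)
  numerator₂ = solve 6 (λ W₁ W₂ W₃ u₁ u₂ u₃ → let open Matₚ (theMatrixₚ W₁ W₂ W₃ u₁ u₂ u₃) in
    m₁₁ :* u₂ :+ m₁₂ := W₂ :* (m₂₁ :* u₂ :+ m₂₂))
    refl W₁ W₂ W₃ u₁ u₂ u₃

  numerator₃ : a * u₃ + b ≈ W₃ * (c * u₃ + d)
  numerator₃ = solve 6 (λ W₁ W₂ W₃ u₁ u₂ u₃ → let open Matₚ (theMatrixₚ W₁ W₂ W₃ u₁ u₂ u₃) in
    m₁₁ :* u₃ :+ m₁₂ := W₃ :* (m₂₁ :* u₃ :+ m₂₂))
    refl W₁ W₂ W₃ u₁ u₂ u₃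

module Proposition {o ℓ} (K : CommutativeRing o ℓ) (r : ℕ) (^-distrib-+ : AdditivePower K (suc (suc r)))
  (u₁ u₂ u₃ w₁ w₂ w₃ : CommutativeRing.Carrier K) where
  open CommutativeRing K
  open RingSolver K
  open import Algebra.Properties.Ring ring using (+-inverseˡ-unique; ⁻¹-anti-homo‿-; -‿involutive)
  open import Algebra.Properties.Semiring.Exp semiring using (_^_; ^-congˡ)
  open import Algebra.Properties.CommutativeSemiring.Exp commutativeSemiring using (^-distrib-*)

  q : ℕ
  q = suc (suc r)

  open TheMatrix K q u₁ u₂ u₃ w₁ w₂ w₃

  F : Carrier → Carrier
  F x = x ^ q

  F-* : ∀ x y → F (x * y) ≈ F x * F y
  F-* x y = ^-distrib-* x y q

  F-neg : ∀ x → F (- x) ≈ - F x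
  F-neg x = +-inverseˡ-unique _ _
    (trans (sym (^-distrib-+ (- x) x)) (trans (^-congˡ q (-‿inverseˡ x)) (zeroˡ _)))

  F-- : ∀ x y → F (x - y) ≈ F x - F y
  F-- x y = trans (^-distrib-+ x (- y)) (+-congˡ (F-neg y))

  module Invertible (K-field : IsField K)
    (u₁≉u₂ : ¬ u₁ ≈ u₂) (u₁≉u₃ : ¬ u₁ ≈ u₃) (u₂≉u₃ : ¬ u₂ ≈ u₃)
    (w₁≉w₂ : ¬ w₁ ≈ w₂) (w₁≉w₃ : ¬ w₁ ≈ w₃) (w₂≉w₃ : ¬ w₂ ≈ w₃) where
    open FieldProperties K K-field
    open import Algebra.Properties.Ring ring using (x∙y⁻¹≈ε⇒x≈y)

    ≉⇒-≉0 : ∀ {x y} → ¬ x ≈ y → ¬ (x - y) ≈ 0#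
    ≉⇒-≉0 x≉y x-y≈0 = x≉y (x∙y⁻¹≈ε⇒x≈y _ _ x-y≈0)

    F-≉ : ∀ {x y} → ¬ x ≈ y → ¬ (F x - F y) ≈ 0#
    F-≉ x≉y Fx-Fy≈0 = ^-≉0 q (≉⇒-≉0 x≉y) (trans (F-- _ _) Fx-Fy≈0)

    α≉0 : ¬ α ≈ 0#
    α≉0 = F-≉ w₁≉w₂

    β≉0 : ¬ β ≈ 0#
    β≉0 = F-≉ w₂≉w₃

    W₃-W₁≉0 : ¬ (W₃ - W₁) ≈ 0#
    W₃-W₁≉0 = F-≉ (λ w₃≈w₁ → w₁≉w₃ (sym w₃≈w₁))

    γ≉0 : ¬ γ ≈ 0#
    γ≉0 = ≉⇒-≉0 u₂≉u₃

    δ≉0 : ¬ δ ≈ 0#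
    δ≉0 = ≉⇒-≉0 u₁≉u₂

    u₃-u₁≉0 : ¬ (u₃ - u₁) ≈ 0#
    u₃-u₁≉0 = ≉⇒-≉0 (λ u₃≈u₁ → u₁≉u₃ (sym u₃≈u₁))

    det≉0 : ¬ (a * d - b * c) ≈ 0#
    det≉0 det≈0 =
      *-≉0 (*-≉0 (*-≉0 (*-≉0 (*-≉0 W₃-W₁≉0 α≉0) β≉0) γ≉0) u₃-u₁≉0) δ≉0 (trans (sym det≈) det≈0)

    sends₁ : MöbiusSends K A u₁ W₁
    sends₁ = (λ ≈0 → *-≉0 (*-≉0 β≉0 δ≉0) u₃-u₁≉0 (trans (sym denominator₁) ≈0)) , numerator₁

    sends₂ : MöbiusSends K A u₂ W₂
    sends₂ = (λ ≈0 → *-≉0 (*-≉0 δ≉0 γ≉0) W₃-W₁≉0 (trans (sym denominator₂) ≈0)) , numerator₂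

    sends₃ : MöbiusSends K A u₃ W₃
    sends₃ = (λ ≈0 → *-≉0 (*-≉0 α≉0 γ≉0) u₃-u₁≉0 (trans (sym denominator₃) ≈0)) , numerator₃

  -- δ ^ q = δ * E, and E lies in the maximal ideal because q ≥ 2.
  E : Carrier
  E = δ ^ suc r

  T P₀ P₁ P R : Carrier
  T  = F X * (F (- u₁) - W₃)
  P₀ = β * F X * (W₁ - F (- u₁))
  P₁ = F u₃ * F β * X - F u₃ * F β * β * δ + W₃ * X * F β - W₁ * β * F β * δ
  P  = P₀ + E * P₁
  R  = F d * c - a * F c

  F-c≈ : F c ≈ F X - F β * (δ * E)
  F-c≈ = trans (^-congˡ q c≈) (trans (F-- X (β * δ)) (+-congˡ (-‿cong (F-* β δ))))

  F-d≈ : F d ≈ F (- u₁) * F X + F u₃ * (F β * (δ * E))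
  F-d≈ = trans (^-congˡ q d≈) (trans (^-distrib-+ _ _)
           (+-cong (F-* (- u₁) X) (trans (F-* u₃ (β * δ)) (*-congˡ (F-* β δ)))))

  R≈ : R ≈ X * T + δ * P
  R≈ = trans (+-cong (*-cong F-d≈ c≈) (-‿cong (*-cong a≈ F-c≈)))
         (solve 10 (λ X β δ W₁ W₃ FX Fβ Fnu₁ Fu₃ E →
            (Fnu₁ :* FX :+ Fu₃ :* (Fβ :* (δ :* E))) :* (X :- β :* δ)
              :- (W₃ :* X :- W₁ :* (β :* δ)) :* (FX :- Fβ :* (δ :* E))
            := X :* (FX :* (Fnu₁ :- W₃))
              :+ δ :* (β :* FX :* (W₁ :- Fnu₁)
                       :+ E :* (Fu₃ :* Fβ :* X :- Fu₃ :* Fβ :* β :* δ :+ W₃ :* X :* Fβ :- W₁ :* β :* Fβ :* δ)))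
            refl X β δ W₁ W₃ (F X) (F β) (F (- u₁)) (F u₃) E)

  module Valuative (0≉1 : ¬ 0# ≈ 1#) (V : DiscreteValuation K) where
    open DiscreteValuation V
    open ValuationProperties K 0≉1 V

    F-unit : ∀ {x y} → IsUnit (x - y) → IsUnit (F x - F y)
    F-unit x-y-unit = unit-cong (F-- _ _) (unit-^ q x-y-unit)

    F-∈𝒪 : ∀ {x} → x ∈𝒪 → F x ∈𝒪
    F-∈𝒪 = ∈𝒪-^ q

    F-∈𝔪² : ∀ {x} → x ∈𝔪 → F x ∈𝔪^ 2
    F-∈𝔪² x∈𝔪 = ∈𝔪^-weaken (s≤s (s≤s z≤n)) (∈𝔪^-^ q x∈𝔪)

    module Assuming
      (u₁∈𝒪 : u₁ ∈𝒪) (u₃∈𝒪 : u₃ ∈𝒪) (w₁∈𝒪 : w₁ ∈𝒪) (w₃∈𝒪 : w₃ ∈𝒪)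
      (w₁-w₂-unit : IsUnit (w₁ - w₂)) (w₁-w₃-unit : IsUnit (w₁ - w₃)) (w₂-w₃-unit : IsUnit (w₂ - w₃))
      (w₃+u₁-unit : IsUnit (w₃ + u₁)) (w₃+u₃-unit : IsUnit (w₃ + u₃))
      (γ-unit : IsUnit (u₂ - u₃)) (v[δ]≡1 : v (u₁ - u₂) ≡ fin (+ 1)) where

      α-unit : IsUnit α
      α-unit = F-unit w₁-w₂-unit

      β-unit : IsUnit β
      β-unit = F-unit w₂-w₃-unit

      W₃-W₁-unit : IsUnit (W₃ - W₁)
      W₃-W₁-unit = F-unit (unit-cong (⁻¹-anti-homo‿- w₁ w₃) (unit-neg w₁-w₃-unit))

      X-unit : IsUnit X
      X-unit = unit-* α-unit γ-unit

      δ∈𝔪 : δ ∈𝔪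
      δ∈𝔪 = ≡.subst (fin (+ 1) ≤∞_) (≡.sym v[δ]≡1) (fin≤fin ℤ.≤-refl)

      u₃-u₁-unit : IsUnit (u₃ - u₁)
      u₃-u₁-unit = unit-cong (solve 3 (λ u₁ u₂ u₃ → :- ((u₂ :- u₃) :+ (u₁ :- u₂)) := u₃ :- u₁) refl u₁ u₂ u₃)
                     (unit-neg (unit+∈𝔪 γ-unit δ∈𝔪))

      D-unit : IsUnit D
      D-unit = unit-* (unit-* (unit-* (unit-* W₃-W₁-unit α-unit) β-unit) γ-unit) u₃-u₁-unit

      -u₁-w₃-unit : IsUnit (- u₁ - w₃)
      -u₁-w₃-unit = unit-cong (solve 2 (λ u₁ w₃ → :- (w₃ :+ u₁) := :- u₁ :- w₃) refl u₁ w₃) (unit-neg w₃+u₁-unit)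

      T-unit : IsUnit T
      T-unit = unit-* (unit-^ q X-unit) (F-unit -u₁-w₃-unit)

      β∈𝒪 : β ∈𝒪
      β∈𝒪 = unit⇒∈𝒪 β-unit

      X∈𝒪 : X ∈𝒪
      X∈𝒪 = unit⇒∈𝒪 X-unit

      D∈𝒪 : D ∈𝒪
      D∈𝒪 = unit⇒∈𝒪 D-unit

      δ∈𝒪 : δ ∈𝒪
      δ∈𝒪 = ∈𝔪^-weaken z≤n δ∈𝔪

      E∈𝔪 : E ∈𝔪
      E∈𝔪 = ∈𝔪^-weaken (s≤s z≤n) (∈𝔪^-^ (suc r) δ∈𝔪)

      P₀∈𝒪 : P₀ ∈𝒪
      P₀∈𝒪 = β∈𝒪 ⟨*⟩ F-∈𝒪 X∈𝒪 ⟨*⟩ (F-∈𝒪 w₁∈𝒪 ⟨-⟩ F-∈𝒪 (⟨-⟩ u₁∈𝒪))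

      P₁∈𝒪 : P₁ ∈𝒪
      P₁∈𝒪 = Fu₃ ⟨*⟩ Fβ ⟨*⟩ X∈𝒪 ⟨-⟩ Fu₃ ⟨*⟩ Fβ ⟨*⟩ β∈𝒪 ⟨*⟩ δ∈𝒪
             ⟨+⟩ F-∈𝒪 w₃∈𝒪 ⟨*⟩ X∈𝒪 ⟨*⟩ Fβ ⟨-⟩ F-∈𝒪 w₁∈𝒪 ⟨*⟩ β∈𝒪 ⟨*⟩ Fβ ⟨*⟩ δ∈𝒪
        where
        Fu₃ : F u₃ ∈𝒪
        Fu₃ = F-∈𝒪 u₃∈𝒪
        Fβ : F β ∈𝒪
        Fβ = F-∈𝒪 β∈𝒪

      P∈𝒪 : P ∈𝒪
      P∈𝒪 = P₀∈𝒪 ⟨+⟩ ∈𝔪^-weaken z≤n E∈𝔪 ⟨*⟩ P₁∈𝒪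

      v-det≡1 : v (a * d - b * c) ≡ fin (+ 1)
      v-det≡1 = ≡.trans (v-cong det≈) (≡.trans (v-* D δ) (≡.cong₂ _+∞_ D-unit v[δ]≡1))

      v-R≡0 : v R ≡ fin (+ 0)
      v-R≡0 = unit-cong (sym R≈) (unit+∈𝔪 (unit-* X-unit T-unit) (δ∈𝔪 ⟨*⟩ P∈𝒪))

      -- T = μ ^ q.
      μ B₀ : Carrier
      μ  = X * (- u₁ - w₃)
      B₀ = - (β * T * μ) - F X * D - μ * P₀

      μ∈𝒪 : μ ∈𝒪
      μ∈𝒪 = X∈𝒪 ⟨*⟩ unit⇒∈𝒪 -u₁-w₃-unit

      B₀-unit : IsUnit B₀
      B₀-unit = unit-cong (sym B₀≈)
        (unit-neg (unit-* (unit-* (unit-* (unit-* (unit-^ q X-unit) X-unit) β-unit) W₃-W₁-unit) w₃+u₃-unit))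
        where
        B₀≈ : B₀ ≈ - (F X * X * β * (W₃ - W₁) * (w₃ + u₃))
        B₀≈ = solve 9 (λ W₁ W₂ W₃ u₁ u₂ u₃ w₃ FX Fnu₁ →
                :- ((W₂ :- W₃) :* (FX :* (Fnu₁ :- W₃)) :* (((W₁ :- W₂) :* (u₂ :- u₃)) :* (:- u₁ :- w₃)))
                :- FX :* ((W₃ :- W₁) :* (W₁ :- W₂) :* (W₂ :- W₃) :* (u₂ :- u₃) :* (u₃ :- u₁))
                :- (((W₁ :- W₂) :* (u₂ :- u₃)) :* (:- u₁ :- w₃)) :* ((W₂ :- W₃) :* FX :* (W₁ :- Fnu₁))
                := :- (FX :* ((W₁ :- W₂) :* (u₂ :- u₃)) :* (W₂ :- W₃) :* (W₃ :- W₁) :* (w₃ :+ u₃)))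
                refl W₁ W₂ W₃ u₁ u₂ u₃ w₃ (F X) (F (- u₁))

      module Congruence (t t⁻¹ : Carrier) (t∈𝒪 : t ∈𝒪) (t⁻¹∈𝒪 : t⁻¹ ∈𝒪) (tt⁻¹≈1 : t * t⁻¹ ≈ 1#)
        (Δ∈𝔪² : ((c * F t - F c * (a * d - b * c) * t⁻¹) - R) ∈𝔪^ 2) where

        L B C : Carrier
        L = F t
        B = - (β * L) - F X * D * t⁻¹ - P
        C = (δ * E) * (δ * (F β * D * t⁻¹))

        Δ≈ : (c * L - F c * (a * d - b * c) * t⁻¹) - R ≈ X * (L - T) + δ * B + C
        Δ≈ = trans (+-cong (+-cong (*-congʳ c≈) (-‿cong (*-congʳ (*-cong F-c≈ det≈)))) (-‿cong R≈))
               (solve 11 (λ X β δ L t⁻¹ FX Fβ E D P T →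
                  ((X :- β :* δ) :* L :- (FX :- Fβ :* (δ :* E)) :* (D :* δ) :* t⁻¹) :- (X :* T :+ δ :* P)
                  := X :* (L :- T) :+ δ :* (:- (β :* L) :- FX :* D :* t⁻¹ :- P)
                     :+ (δ :* E) :* (δ :* (Fβ :* D :* t⁻¹)))
                  refl X β δ L t⁻¹ (F X) (F β) E D P T)

        X[L-T]+δB+C∈𝔪² : (X * (L - T) + δ * B + C) ∈𝔪^ 2
        X[L-T]+δB+C∈𝔪² = ∈𝔪^-cong Δ≈ Δ∈𝔪²

        L∈𝒪 : L ∈𝒪
        L∈𝒪 = F-∈𝒪 t∈𝒪

        B∈𝒪 : B ∈𝒪
        B∈𝒪 = ⟨-⟩ (β∈𝒪 ⟨*⟩ L∈𝒪) ⟨-⟩ F-∈𝒪 X∈𝒪 ⟨*⟩ D∈𝒪 ⟨*⟩ t⁻¹∈𝒪 ⟨-⟩ P∈𝒪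

        C∈𝔪² : C ∈𝔪^ 2
        C∈𝔪² = F-∈𝔪² δ∈𝔪 ⟨*⟩ (δ∈𝒪 ⟨*⟩ (F-∈𝒪 β∈𝒪 ⟨*⟩ D∈𝒪 ⟨*⟩ t⁻¹∈𝒪))

        L-T∈𝔪 : (L - T) ∈𝔪
        L-T∈𝔪 = ∈𝔪^-cancelˡ X-unit (∈𝔪^-+⁻ˡ (∈𝔪^-+⁻ˡ (𝔪²⊆𝔪 X[L-T]+δB+C∈𝔪²) (𝔪²⊆𝔪 C∈𝔪²)) (δ∈𝔪 ⟨*⟩ B∈𝒪))
          where
          𝔪²⊆𝔪 : ∀ {x} → x ∈𝔪^ 2 → x ∈𝔪
          𝔪²⊆𝔪 = ∈𝔪^-weaken (s≤s z≤n)

        F[t-μ]≈L-T : F (t - μ) ≈ L - T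
        F[t-μ]≈L-T = trans (F-- t μ) (+-congˡ (-‿cong (trans (F-* X _) (*-congˡ (F-- (- u₁) w₃)))))

        t-μ∈𝔪 : (t - μ) ∈𝔪
        t-μ∈𝔪 = ^-∈𝔪⇒∈𝔪 (suc r) (t∈𝒪 ⟨-⟩ μ∈𝒪) (∈𝔪^-cong (sym F[t-μ]≈L-T) L-T∈𝔪)

        L-T∈𝔪² : (L - T) ∈𝔪^ 2
        L-T∈𝔪² = ∈𝔪^-cong F[t-μ]≈L-T (F-∈𝔪² t-μ∈𝔪)

        B∈𝔪 : B ∈𝔪
        B∈𝔪 = ∈𝔪^-cancelˡ v[δ]≡1 (∈𝔪^-+⁻ʳ (∈𝔪^-+⁻ˡ X[L-T]+δB+C∈𝔪² C∈𝔪²) (X∈𝒪 ⟨*⟩ L-T∈𝔪²))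

        tB-B₀≈ : t * B - B₀ ≈ - (β * L * (t - μ)) - β * μ * (L - T) - F X * D * (t * t⁻¹ - 1#)
                              - (t - μ) * P₀ - t * E * P₁
        tB-B₀≈ = solve 11 (λ t L T μ β FX D t⁻¹ P₀ E P₁ →
          t :* (:- (β :* L) :- FX :* D :* t⁻¹ :- (P₀ :+ E :* P₁)) :- (:- (β :* T :* μ) :- FX :* D :- μ :* P₀)
          := :- (β :* L :* (t :- μ)) :- β :* μ :* (L :- T) :- FX :* D :* (t :* t⁻¹ :- con (1 , 0))
             :- (t :- μ) :* P₀ :- t :* E :* P₁)
          refl t L T μ β (F X) D t⁻¹ P₀ E P₁

        B₀∈𝔪 : B₀ ∈𝔪
        B₀∈𝔪 = ∈𝔪^-cong (-‿involutive B₀) (⟨-⟩ ∈𝔪^-+⁻ʳ (∈𝔪^-cong (sym tB-B₀≈) tB-B₀∈𝔪) (t∈𝒪 ⟨*⟩ B∈𝔪))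
          where
          tt⁻¹-1∈𝔪 : (t * t⁻¹ - 1#) ∈𝔪
          tt⁻¹-1∈𝔪 = ≈0#⇒∈𝔪^ 1 (trans (+-congʳ tt⁻¹≈1) (-‿inverseʳ 1#))
          tB-B₀∈𝔪 : (- (β * L * (t - μ)) - β * μ * (L - T) - F X * D * (t * t⁻¹ - 1#)
                      - (t - μ) * P₀ - t * E * P₁) ∈𝔪
          tB-B₀∈𝔪 = ⟨-⟩ (β∈𝒪 ⟨*⟩ L∈𝒪 ⟨*⟩ t-μ∈𝔪) ⟨-⟩ β∈𝒪 ⟨*⟩ μ∈𝒪 ⟨*⟩ L-T∈𝔪 ⟨-⟩ F-∈𝒪 X∈𝒪 ⟨*⟩ D∈𝒪 ⟨*⟩ tt⁻¹-1∈𝔪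
                    ⟨-⟩ t-μ∈𝔪 ⟨*⟩ P₀∈𝒪 ⟨-⟩ t∈𝒪 ⟨*⟩ E∈𝔪 ⟨*⟩ P₁∈𝒪

      not-congruent : ∀ π → IsGenerator𝔪 π → ∀ t t⁻¹ → t ∈𝒪 → t⁻¹ ∈𝒪 → t * t⁻¹ ≈ 1# →
                      ¬ CongMod (π * π) (c * F t - F c * (a * d - b * c) * t⁻¹) R
      not-congruent π (π∈𝔪 , _) t t⁻¹ t∈𝒪 t⁻¹∈𝒪 tt⁻¹≈1 (z , z∈𝒪 , Δ≈π²z) =
        unit∉𝔪 B₀-unit (B₀∈𝔪 (∈𝔪^-cong (sym Δ≈π²z) (π∈𝔪 ⟨*⟩ π∈𝔪 ⟨*⟩ z∈𝒪)))
        where open Congruence t t⁻¹ t∈𝒪 t⁻¹∈𝒪 tt⁻¹≈1 using (B₀∈𝔪)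

module _ {o ℓ} (K : CommutativeRing o ℓ) {q : ℕ} (ext : ExtensionOf𝔽 K q) where
  open CommutativeRing K
  open ExtensionOf𝔽 ext
  open CharacteristicP commutativeSemiring using (freshman's-dream-^)

  2≤q : 2 ℕ.≤ q
  2≤q = ≡.subst (2 ℕ.≤_) (≡.sym q≡p^k) (ℕ.^-monoʳ-< p (ℕ.nonTrivial⇒n>1 p {{prime⇒nonTrivial p-prime}}) k≥1)

  frobenius-+ : AdditivePower K q
  frobenius-+ = ≡.subst (AdditivePower K) (≡.sym q≡p^k) (freshman's-dream-^ p-prime char k)

proposition7p2 :
  ∀ {c ℓ} (K : CommutativeRing c ℓ) → IsField K →
  (q : ℕ) → ExtensionOf𝔽 K q →
  (u₁ u₂ u₃ w₁ w₂ w₃ : CommutativeRing.Carrier K) →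
  Distinct K (u₁ ∷ u₂ ∷ u₃ ∷ w₁ ∷ w₂ ∷ w₃ ∷ []) →
  let open CommutativeRing K
      _^_ = pow K
      A = theMatrix K q u₁ u₂ u₃ w₁ w₂ w₃
      a = M₂.m₁₁ A
      b = M₂.m₁₂ A
      c = M₂.m₂₁ A
      d = M₂.m₂₂ A
  in
  -- (a b ; c d) ∈ GL₂(K) and its Möbius transformation sends uᵢ ↦ wᵢ^q
  ( ¬ (a * d - b * c ≈ 0#)
  × MöbiusSends K A u₁ (w₁ ^ q)
  × MöbiusSends K A u₂ (w₂ ^ q)
  × MöbiusSends K A u₃ (w₃ ^ q) )
  ×
  ( (V : DiscreteValuation K) →
    let open DiscreteValuation V in
    u₁ ∈𝒪 → u₂ ∈𝒪 → u₃ ∈𝒪 → w₁ ∈𝒪 → w₂ ∈𝒪 → w₃ ∈𝒪 →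
    v (w₁ - w₂) ≡ fin (+ 0) → v (w₁ - w₃) ≡ fin (+ 0) → v (w₂ - w₃) ≡ fin (+ 0) →
    v (w₃ + u₁) ≡ fin (+ 0) → v (w₃ + u₂) ≡ fin (+ 0) → v (w₃ + u₃) ≡ fin (+ 0) →
    v (u₂ - u₃) ≡ fin (+ 0) →
    v (u₁ - u₂) ≡ fin (+ 1) →
    ( v (a * d - b * c) ≡ fin (+ 1)
    × v ((d ^ q) * c - a * (c ^ q)) ≡ fin (+ 0)
    × ( ∀ π → IsGenerator𝔪 π →
        ∀ t t⁻¹ → t ∈𝒪 → t⁻¹ ∈𝒪 → t * t⁻¹ ≈ 1# →
        ¬ CongMod (π * π) (c * (t ^ q) - (c ^ q) * (a * d - b * c) * t⁻¹)
                          ((d ^ q) * c - a * (c ^ q)) ) ) )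
proposition7p2 K K-field q ext u₁ u₂ u₃ w₁ w₂ w₃
  ((u₁≉u₂ ∷ u₁≉u₃ ∷ _ ∷ _ ∷ _ ∷ []) ∷ (u₂≉u₃ ∷ _ ∷ _ ∷ _ ∷ []) ∷ _ ∷ (w₁≉w₂ ∷ w₁≉w₃ ∷ []) ∷ (w₂≉w₃ ∷ []) ∷ [] ∷ [])
  with 2≤q K ext
... | s≤s (s≤s {n = r} _) =
  (det≉0 , sends₁ , sends₂ , sends₃) ,
  λ V u₁∈𝒪 _ u₃∈𝒪 w₁∈𝒪 _ w₃∈𝒪 w₁-w₂-unit w₁-w₃-unit w₂-w₃-unit w₃+u₁-unit _ w₃+u₃-unit γ-unit v[δ]≡1 →
    let open Valuative.Assuming (IsField.0≉1 K-field) V u₁∈𝒪 u₃∈𝒪 w₁∈𝒪 w₃∈𝒪 w₁-w₂-unit w₁-w₃-unit w₂-w₃-unit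
                       w₃+u₁-unit w₃+u₃-unit γ-unit v[δ]≡1
    in v-det≡1 , v-R≡0 , not-congruent
  where
  open Proposition K r (frobenius-+ K ext) u₁ u₂ u₃ w₁ w₂ w₃
  open Invertible K-field u₁≉u₂ u₁≉u₃ u₂≉u₃ w₁≉w₂ w₁≉w₃ w₂≉w₃
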